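{- Let $\mathcal{J}=\mathcal{I}(100,101,102,201)$ be the set of inversion sequences avoiding the patterns $100,101,102,201$. For $n\ge0$ and $h\ge0$ let $\mathcal{A}_{n,h}$ be the set of non-decreasing inversion sequences of length $n$ ending with value $h$ (with the empty sequence in $\mathcal{A}_{0,0}$), and for $\ell\ge0$ let $\mathcal{E}^{(1)}_{n,\ell}$ be the set of $a\in\mathcal{J}$ of length $n$ with $a_n=\ell<\max(a)$. Then every element of $\mathcal{J}$ lies in exactly one of these sets, and the one-letter right extensions behave as follows (this is the succession rule with root $(0,0)_a$, $(n,h)_a\leadsto(n+1,i)_a$ for $i\in[h,n]$, $(n,h)_a\leadsto(i)_{e^{(1)}}$ for $i\in[0,h-1]$, $(\ell)_{e^{(1)}}\leadsto(i)_{e^{(1)}}$ for $i\in[0,\ell-1]$): for $a\in\mathcal{A}_{n,h}$, the sequences $a\circ(i)$ lying in $\mathcal{J}$ are exactly those with $i\in[h,n]$, which lie in $\mathcal{A}_{n+1,i}$, and those with $i\in[0,h-1]$, which lie in $\mathcal{E}^{(1)}_{n+1,i}$; for $a\in\mathcal{E}^{(1)}_{n,\ell}$, the sequences $a\circ(i)$ lying in $\mathcal{J}$ are exactly those with $i\in[0,\ell-1]$, which lie in $\mathcal{E}^{(1)}_{n+1,i}$.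
   Context: An inversion sequence of length $n$ is an integer sequence $(a_1,\dots,a_n)$ with $0\le a_i<i$ for all $i$; $a\circ(i)$ denotes appending the value $i$. A sequence contains a pattern $\sigma$ of length $k$ if some subsequence $a_{i_1}\cdots a_{i_k}$ ($i_1<\dots<i_k$) has the same relative order (including equalities) as $\sigma$, and avoids it otherwise. $\max(a)$ is the largest entry of $a$ (taken to be $0$ for the empty sequence). -}

module Defs where

open import Data.Nat using (ℕ; zero; suc; _<_; _≤_; _⊔_)
open import Data.Fin using (Fin; toℕ)
open import Data.List using (List; []; _∷_; length; lookup; foldr; _∷ʳ_)
open import Data.List.Relation.Binary.Pointwise using (Pointwise)
open import Data.List.Relation.Binary.Sublist.Propositional using (_⊆_)
open import Data.List.Relation.Unary.Linked using (Linked)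
open import Data.Product using (_×_; ∃; Σ)
open import Data.Unit using (⊤)
open import Data.Empty using (⊥)
open import Relation.Nullary using (¬_)
open import Relation.Binary.PropositionalEquality using (_≡_)
open import Function.Bundles using (_⇔_)

-- Inversion sequence (a_1,…,a_n) with 0 ≤ a_i < i; with 0-based index k = i-1
-- this reads  a[k] < k + 1.
IsInv : List ℕ → Set
IsInv a = (k : Fin (length a)) → lookup a k < suc (toℕ k)

SameCmp : ℕ → ℕ → ℕ → ℕ → Set
SameCmp x x′ y y′ = ((x < x′) ⇔ (y < y′)) × ((x ≡ x′) ⇔ (y ≡ y′))

SameOrder : List ℕ → List ℕ → Set
SameOrder [] [] = ⊤
SameOrder [] (_ ∷ _) = ⊥
SameOrder (_ ∷ _) [] = ⊥
SameOrder (x ∷ xs) (y ∷ ys) =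
  Pointwise (λ x′ y′ → SameCmp x x′ y y′ × SameCmp x′ x y′ y) xs ys × SameOrder xs ys

Contains : List ℕ → List ℕ → Set
Contains σ a = ∃ λ b → (b ⊆ a) × SameOrder b σ

Avoids : List ℕ → List ℕ → Set
Avoids σ a = ¬ Contains σ a

maxL : List ℕ → ℕ
maxL = foldr _⊔_ 0

lastOr0 : List ℕ → ℕ
lastOr0 [] = 0
lastOr0 (x ∷ []) = x
lastOr0 (_ ∷ y ∷ ys) = lastOr0 (y ∷ ys)

InJ : List ℕ → Set
InJ a = IsInv a
      × Avoids (1 ∷ 0 ∷ 0 ∷ []) a
      × Avoids (1 ∷ 0 ∷ 1 ∷ []) a
      × Avoids (1 ∷ 0 ∷ 2 ∷ []) a
      × Avoids (2 ∷ 0 ∷ 1 ∷ []) a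

InA : ℕ → ℕ → List ℕ → Set
InA n h a = IsInv a × Linked _≤_ a × length a ≡ n × lastOr0 a ≡ h

InE : ℕ → ℕ → List ℕ → Set
InE n ℓ a = InJ a × length a ≡ n × lastOr0 a ≡ ℓ × ℓ < maxL a

data Label : Set where
  lblA : ℕ → ℕ → Label
  lblE : ℕ → ℕ → Label

InLabel : Label → List ℕ → Set
InLabel (lblA n h) a = InA n h a
InLabel (lblE n ℓ) a = InE n ℓ a

{-# OPTIONS --safe #-}

-- The patterns 100, 101, 102, 201 are exactly the order types of triples a_i > a_j ≤ a_k
-- with i < j < k, so 𝒥 is the set of inversion sequences without such a "valley".
-- In a valley-free sequence every descent a_i > a_j ends at a value a_j ≥ a_n, since
-- otherwise a_i a_j a_n is a valley.  Inducting on the last entry, a valley-free sequence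
-- is either non-decreasing or has a_n < max(a), and then a_n itself ends a descent.
-- Appending i creates a valley exactly when some descent of a ends at a value ≤ i:
-- never if a is non-decreasing, and precisely when i ≥ a_n if a ∈ ℰ⁽¹⁾.
module Submission where

open import Defs
open import Data.Nat using (ℕ; suc; _+_; _<_; _≤_; _⊔_; z≤n; s≤s; z<s; s<s; _<?_)
open import Data.Nat.Properties
open import Data.Fin using (Fin; toℕ)
import Data.Fin as Fin
open import Data.List using (List; []; _∷_; _∷ʳ_; length; lookup)
open import Data.List.Properties using (length-++)
open import Data.List.Reverse using (Reverse; []; _∶_∶ʳ_; reverseView)
open import Data.List.Membership.Propositional.Properties using (foldr-selective)
open import Data.List.Relation.Binary.Pointwise using ([]; _∷_)
open import Data.List.Relation.Binary.Sublist.Propositional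
  using (_⊆_; []; _∷_; minimum; from∈)
  renaming (_∷ʳ_ to _skip_)
open import Data.List.Relation.Binary.Sublist.Propositional.Properties
  using (++⁺; ++⁺ʳ; All-resp-⊆)
open import Data.List.Relation.Unary.All using (_∷_)
open import Data.List.Relation.Unary.AllPairs using (AllPairs; []; _∷_)
open import Data.List.Relation.Unary.Linked using (Linked; []; [-]; _∷_)
open import Data.List.Relation.Unary.Linked.Properties using (Linked⇒AllPairs)
open import Data.Product using (_×_; _,_; ∃; ∃!; swap)
import Data.Product as Product
open import Data.Sum using (_⊎_; inj₁; inj₂)
import Data.Sum as Sum
open import Data.Unit using (tt)
open import Data.Empty using (⊥-elim)
open import Function using (_∘_; const)
open import Function.Bundles using (_⇔_; mk⇔; Equivalence)
open import Level using (Level)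
open import Relation.Nullary using (¬_; yes; no)
open import Relation.Binary.Core using (Rel)
open import Relation.Binary.Definitions using (tri<; tri≈; tri>)
open import Relation.Binary.PropositionalEquality using (_≡_; refl; sym; trans; cong; subst; subst₂)

private
  variable
    ℓ : Level
    A : Set ℓ
    x y z i j p q r : ℕ
    a b : List ℕ

∷ʳ-⊈-[] : ∀ (xs : List A) {z : A} → ¬ (xs ∷ʳ z) ⊆ []
∷ʳ-⊈-[] []      ()
∷ʳ-⊈-[] (_ ∷ _) ()

∷ʳ-⊆-∷ʳ⁻ : ∀ {xs : List A} {z i : A} as →
           (xs ∷ʳ z) ⊆ (as ∷ʳ i) → (xs ∷ʳ z) ⊆ as ⊎ (z ≡ i × xs ⊆ as)
∷ʳ-⊆-∷ʳ⁻ {xs = []}     []       (_ skip ())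
∷ʳ-⊆-∷ʳ⁻ {xs = []}     []       (refl ∷ p) = inj₂ (refl , p)
∷ʳ-⊆-∷ʳ⁻ {xs = _ ∷ _}  []       (_ skip ())
∷ʳ-⊆-∷ʳ⁻ {xs = _ ∷ xs} []       (refl ∷ p) = ⊥-elim (∷ʳ-⊈-[] xs p)
∷ʳ-⊆-∷ʳ⁻                (w ∷ as) (_ skip p) =
  Sum.map (w skip_) (Product.map₂ (w skip_)) (∷ʳ-⊆-∷ʳ⁻ as p)
∷ʳ-⊆-∷ʳ⁻ {xs = []}     (w ∷ as) (refl ∷ p) = inj₁ (refl ∷ minimum as)
∷ʳ-⊆-∷ʳ⁻ {xs = _ ∷ _}  (w ∷ as) (refl ∷ p) =
  Sum.map (refl ∷_) (Product.map₂ (refl ∷_)) (∷ʳ-⊆-∷ʳ⁻ as p)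

AllPairs-resp-⊆ : ∀ {r} {R : Rel A r} {xs ys : List A} →
                  xs ⊆ ys → AllPairs R ys → AllPairs R xs
AllPairs-resp-⊆ []         []         = []
AllPairs-resp-⊆ (_ skip p) (_ ∷ rs)   = AllPairs-resp-⊆ p rs
AllPairs-resp-⊆ (refl ∷ p) (rx ∷ rs)  = All-resp-⊆ p rx ∷ AllPairs-resp-⊆ p rs

Linked-⊆ : ∀ {zs} → Linked _≤_ a → (x ∷ y ∷ zs) ⊆ a → x ≤ y
Linked-⊆ sorted p with AllPairs-resp-⊆ p (Linked⇒AllPairs ≤-trans sorted)
... | (x≤y ∷ _) ∷ _ = x≤y

m<n⊔m⇒m<n : x < y ⊔ x → x < y
m<n⊔m⇒m<n {x} {y} x<y⊔x with x <? y
... | yes x<y = x<y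
... | no x≮y  = ⊥-elim (<-irrefl (sym (m≤n⇒m⊔n≡n (≮⇒≥ x≮y))) x<y⊔x)

lastOr0-∷ʳ : ∀ a i → lastOr0 (a ∷ʳ i) ≡ i
lastOr0-∷ʳ []          i = refl
lastOr0-∷ʳ (_ ∷ [])    i = refl
lastOr0-∷ʳ (_ ∷ w ∷ a) i = lastOr0-∷ʳ (w ∷ a) i

length-∷ʳ : ∀ (a : List ℕ) i → length (a ∷ʳ i) ≡ suc (length a)
length-∷ʳ a i = trans (length-++ a) (+-comm (length a) 1)

maxL-∷ʳ : ∀ a i → maxL (a ∷ʳ i) ≡ maxL a ⊔ i
maxL-∷ʳ []      i = ⊔-identityʳ i
maxL-∷ʳ (w ∷ a) i = trans (cong (w ⊔_) (maxL-∷ʳ a i)) (sym (⊔-assoc w (maxL a) i))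

lastOr0≤maxL : ∀ a → lastOr0 a ≤ maxL a
lastOr0≤maxL []          = z≤n
lastOr0≤maxL (w ∷ [])    = m≤m⊔n w 0
lastOr0≤maxL (w ∷ v ∷ a) = ≤-trans (lastOr0≤maxL (v ∷ a)) (m≤n⊔m w _)

<lastOr0⇒<maxL-∷ʳ : ∀ a → j < lastOr0 a → j < maxL (a ∷ʳ i)
<lastOr0⇒<maxL-∷ʳ {i = i} a j<h = begin-strict
  _              <⟨ j<h ⟩
  lastOr0 a      ≤⟨ lastOr0≤maxL a ⟩
  maxL a         ≤⟨ m≤m⊔n (maxL a) i ⟩
  maxL a ⊔ i     ≡⟨ maxL-∷ʳ a i ⟨
  maxL (a ∷ʳ i)  ∎
  where open ≤-Reasoning

maxL≤lastOr0 : Linked _≤_ a → maxL a ≤ lastOr0 a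
maxL≤lastOr0 []                = z≤n
maxL≤lastOr0 {x ∷ []} [-]      = ≤-reflexive (⊔-identityʳ x)
maxL≤lastOr0 (x≤y ∷ sorted) =
  ⊔-lub (≤-trans x≤y (≤-trans (m≤m⊔n _ _) (maxL≤lastOr0 sorted))) (maxL≤lastOr0 sorted)

Linked-∷ʳ⁺ : Linked _≤_ a → lastOr0 a ≤ i → Linked _≤_ (a ∷ʳ i)
Linked-∷ʳ⁺ []               _   = [-]
Linked-∷ʳ⁺ [-]              h≤i = h≤i ∷ [-]
Linked-∷ʳ⁺ (x≤y ∷ sorted) h≤i = x≤y ∷ Linked-∷ʳ⁺ sorted h≤i

-- a is what remains of an inversion sequence after dropping its first o entries;
-- IsInv is IsInvFrom 0 definitionally, and the offset is what makes induction on a work.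
IsInvFrom : ℕ → List ℕ → Set
IsInvFrom o a = (k : Fin (length a)) → lookup a k < suc (o + toℕ k)

IsInvFrom-∷⁻ : ∀ o w a → IsInvFrom o (w ∷ a) → IsInvFrom (suc o) a
IsInvFrom-∷⁻ o w a inv k = subst (λ t → lookup a k < suc t) (+-suc o (toℕ k)) (inv (Fin.suc k))

IsInvFrom-∷ʳ⁺ : ∀ o a → IsInvFrom o a → i < suc (o + length a) → IsInvFrom o (a ∷ʳ i)
IsInvFrom-∷ʳ⁺ o []      inv i<  Fin.zero    = i<
IsInvFrom-∷ʳ⁺ o (w ∷ a) inv i<  Fin.zero    = inv Fin.zero
IsInvFrom-∷ʳ⁺ {i} o (w ∷ a) inv i< (Fin.suc k) =
  subst (λ t → lookup (a ∷ʳ i) k < suc t) (sym (+-suc o (toℕ k)))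
    (IsInvFrom-∷ʳ⁺ (suc o) a (IsInvFrom-∷⁻ o w a inv)
      (subst (λ t → i < suc t) (+-suc o (length a)) i<) k)

IsInvFrom-∷ʳ⁻ : ∀ o a → IsInvFrom o (a ∷ʳ i) → i < suc (o + length a)
IsInvFrom-∷ʳ⁻ o []      inv = inv Fin.zero
IsInvFrom-∷ʳ⁻ {i} o (w ∷ a) inv =
  subst (λ t → i < suc t) (sym (+-suc o (length a)))
    (IsInvFrom-∷ʳ⁻ (suc o) a (IsInvFrom-∷⁻ o w (a ∷ʳ i) inv))

IsInv-∷ʳ⁺ : ∀ a → IsInv a → i ≤ length a → IsInv (a ∷ʳ i)
IsInv-∷ʳ⁺ a inv i≤n = IsInvFrom-∷ʳ⁺ 0 a inv (s≤s i≤n)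

IsInv-∷ʳ⁻ : ∀ a → IsInv (a ∷ʳ i) → i ≤ length a
IsInv-∷ʳ⁻ a inv = ≤-pred (IsInvFrom-∷ʳ⁻ 0 a inv)

lastOr0≤length : ∀ a → IsInv a → lastOr0 a ≤ length a
lastOr0≤length a = go (reverseView a)
  where
  go : ∀ {a} → Reverse a → IsInv a → lastOr0 a ≤ length a
  go []              _   = z≤n
  go (a ∶ _ ∶ʳ l) inv =
    subst₂ _≤_ (sym (lastOr0-∷ʳ a l)) (sym (length-∷ʳ a l)) (m≤n⇒m≤1+n (IsInv-∷ʳ⁻ a inv))

DescentTo : List ℕ → ℕ → Set
DescentTo a y = ∃ λ x → (x ∷ y ∷ []) ⊆ a × y < x

data Valley (a : List ℕ) : Set where
  valley : (x ∷ y ∷ z ∷ []) ⊆ a → y < x → y ≤ z → Valley a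

Valley-∷ʳ : Valley a → Valley (a ∷ʳ i)
Valley-∷ʳ {i = i} (valley p y<x y≤z) = valley (++⁺ʳ (i ∷ []) p) y<x y≤z

DescentTo⇒Valley-∷ʳ : DescentTo a y → y ≤ i → Valley (a ∷ʳ i)
DescentTo⇒Valley-∷ʳ (_ , p , y<x) y≤i = valley (++⁺ p (refl ∷ [])) y<x y≤i

Valley-∷ʳ⁻ : ∀ a → Valley (a ∷ʳ i) → Valley a ⊎ ∃ λ y → DescentTo a y × y ≤ i
Valley-∷ʳ⁻ a (valley p y<x y≤z) with ∷ʳ-⊆-∷ʳ⁻ {xs = _ ∷ _ ∷ []} a p
... | inj₁ q          = inj₁ (valley q y<x y≤z)
... | inj₂ (refl , q) = inj₂ (_ , (_ , q , y<x) , y≤z)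

Linked⇒¬DescentTo : Linked _≤_ a → ¬ DescentTo a y
Linked⇒¬DescentTo sorted (_ , p , y<x) = <⇒≱ y<x (Linked-⊆ sorted p)

Linked⇒¬Valley-∷ʳ : Linked _≤_ a → ¬ Valley (a ∷ʳ i)
Linked⇒¬Valley-∷ʳ {a = a} sorted v with Valley-∷ʳ⁻ a v
... | inj₁ (valley p y<x _) = <⇒≱ y<x (Linked-⊆ sorted p)
... | inj₂ (_ , d , _)      = Linked⇒¬DescentTo sorted d

lastOr0<maxL⇒DescentTo : ∀ a → lastOr0 a < maxL a → DescentTo a (lastOr0 a)
lastOr0<maxL⇒DescentTo a = go (reverseView a)
  where
  go : ∀ {a} → Reverse a → lastOr0 a < maxL a → DescentTo a (lastOr0 a)
  go []             ()
  go (a ∶ _ ∶ʳ l) l<max rewrite lastOr0-∷ʳ a l | maxL-∷ʳ a l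
    with m<n⊔m⇒m<n l<max | foldr-selective ⊔-sel 0 a
  ... | l<maxa | inj₁ max≡0 = ⊥-elim (n≮0 (subst (l <_) max≡0 l<maxa))
  ... | l<maxa | inj₂ max∈a = maxL a , ++⁺ (from∈ max∈a) (refl ∷ []) , l<maxa

¬Valley⇒lastOr0≤DescentTo : ∀ a → ¬ Valley a → DescentTo a y → lastOr0 a ≤ y
¬Valley⇒lastOr0≤DescentTo a = go (reverseView a)
  where
  go : ∀ {a y} → Reverse a → ¬ Valley a → DescentTo a y → lastOr0 a ≤ y
  go {y = y} (a ∶ _ ∶ʳ l) ¬v (x , p , y<x) rewrite lastOr0-∷ʳ a l
    with ∷ʳ-⊆-∷ʳ⁻ {xs = x ∷ []} a p
  ... | inj₂ (refl , _) = ≤-refl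
  ... | inj₁ q with y <? l
  ...   | yes y<l = ⊥-elim (¬v (DescentTo⇒Valley-∷ʳ (x , q , y<x) (<⇒≤ y<l)))
  ...   | no y≮l  = ≮⇒≥ y≮l

¬Valley⇒Linked⊎lastOr0<maxL : ∀ a → ¬ Valley a → Linked _≤_ a ⊎ lastOr0 a < maxL a
¬Valley⇒Linked⊎lastOr0<maxL a = go (reverseView a)
  where
  go : ∀ {a} → Reverse a → ¬ Valley a → Linked _≤_ a ⊎ lastOr0 a < maxL a
  go []            _  = inj₁ []
  go (a ∶ r ∶ʳ l) ¬v rewrite lastOr0-∷ʳ a l with l <? lastOr0 a
  ... | yes l<h = inj₂ (<lastOr0⇒<maxL-∷ʳ a l<h)
  ... | no l≮h with go r (¬v ∘ Valley-∷ʳ)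
  ...   | inj₁ sorted = inj₁ (Linked-∷ʳ⁺ sorted (≮⇒≥ l≮h))
  ...   | inj₂ h<max  =
    ⊥-elim (¬v (DescentTo⇒Valley-∷ʳ (lastOr0<maxL⇒DescentTo a h<max) (≮⇒≥ l≮h)))

OrderedAlike : ℕ → ℕ → ℕ → ℕ → Set
OrderedAlike x x′ p q = SameCmp x x′ p q × SameCmp x′ x q p

both⇔ : ∀ {A B : Set} → A → B → A ⇔ B
both⇔ a b = mk⇔ (const b) (const a)

neither⇔ : ∀ {A B : Set} → ¬ A → ¬ B → A ⇔ B
neither⇔ ¬a ¬b = mk⇔ (⊥-elim ∘ ¬a) (⊥-elim ∘ ¬b)

alike-< : x < y → p < q → OrderedAlike x y p q
alike-< x<y p<q =
  (both⇔ x<y p<q , neither⇔ (<⇒≢ x<y) (<⇒≢ p<q)) ,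
  (neither⇔ (<-asym x<y) (<-asym p<q) , neither⇔ (>⇒≢ x<y) (>⇒≢ p<q))

alike-> : y < x → q < p → OrderedAlike x y p q
alike-> y<x q<p = swap (alike-< y<x q<p)

alike-≡ : x ≡ y → p ≡ q → OrderedAlike x y p q
alike-≡ refl refl =
  (neither⇔ (<-irrefl refl) (<-irrefl refl) , both⇔ refl refl) ,
  (neither⇔ (<-irrefl refl) (<-irrefl refl) , both⇔ refl refl)

SameOrder₃ : OrderedAlike x y p q → OrderedAlike x z p r → OrderedAlike y z q r →
             SameOrder (x ∷ y ∷ z ∷ []) (p ∷ q ∷ r ∷ [])
SameOrder₃ xy xz yz = (xy ∷ xz ∷ []) , (yz ∷ []) , [] , tt

InJ⇒¬Valley : InJ a → ¬ Valley a
InJ⇒¬Valley (_ , avoid100 , avoid101 , avoid102 , avoid201) (valley {x} {y} {z} p y<x y≤z)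
  with m≤n⇒m<n∨m≡n y≤z
... | inj₂ refl = avoid100
  (_ , p , SameOrder₃ (alike-> y<x z<s) (alike-> y<x z<s) (alike-≡ refl refl))
... | inj₁ y<z with <-cmp z x
...   | tri< z<x _ _  = avoid201
  (_ , p , SameOrder₃ (alike-> y<x z<s) (alike-> z<x (s<s z<s)) (alike-< y<z z<s))
...   | tri≈ _ refl _ = avoid101
  (_ , p , SameOrder₃ (alike-> y<x z<s) (alike-≡ refl refl) (alike-< y<z z<s))
...   | tri> _ _ x<z  = avoid102
  (_ , p , SameOrder₃ (alike-> y<x z<s) (alike-< x<z (s<s z<s)) (alike-< y<z z<s))

occurrence⇒Valley : q < p → q ≤ r → b ⊆ a → SameOrder b (p ∷ q ∷ r ∷ []) → Valley a
occurrence⇒Valley {b = _ ∷ y ∷ z ∷ []} q<p q≤r b⊆a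
  (((_ , y<x⇔q<p , _) ∷ _ ∷ []) , (((y<z⇔q<r , y≡z⇔q≡r) , _) ∷ []) , _) =
  valley b⊆a (from y<x⇔q<p q<p) y≤z
  where
  open Equivalence using (from)
  y≤z : y ≤ z
  y≤z = Sum.[ <⇒≤ ∘ from y<z⇔q<r , ≤-reflexive ∘ from y≡z⇔q≡r ]′ (m≤n⇒m<n∨m≡n q≤r)

¬Valley⇒InJ : IsInv a → ¬ Valley a → InJ a
¬Valley⇒InJ inv ¬v = inv , avoid z<s z≤n , avoid z<s z≤n , avoid z<s z≤n , avoid z<s z≤n
  where
  avoid : q < p → q ≤ r → Avoids (p ∷ q ∷ r ∷ []) _
  avoid q<p q≤r (_ , b⊆a , same) = ¬v (occurrence⇒Valley q<p q≤r b⊆a same)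

¬Valley-∷ʳ-below-last : ∀ a → ¬ Valley a → i < lastOr0 a → ¬ Valley (a ∷ʳ i)
¬Valley-∷ʳ-below-last a ¬v i<h v with Valley-∷ʳ⁻ a v
... | inj₁ v′             = ¬v v′
... | inj₂ (_ , d , y≤i) = <⇒≱ (<-≤-trans i<h (¬Valley⇒lastOr0≤DescentTo a ¬v d)) y≤i

InE-∷ʳ : ∀ a → IsInv a → ¬ Valley (a ∷ʳ i) → i < lastOr0 a → InE (suc (length a)) i (a ∷ʳ i)
InE-∷ʳ {i} a inv ¬v i<h =
  ¬Valley⇒InJ (IsInv-∷ʳ⁺ a inv (<⇒≤ (<-≤-trans i<h (lastOr0≤length a inv)))) ¬v ,
  length-∷ʳ a i , lastOr0-∷ʳ a i , <lastOr0⇒<maxL-∷ʳ a i<h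

InA⇒¬InE : ∀ {n h m ℓ} → InA n h a → ¬ InE m ℓ a
InA⇒¬InE (_ , sorted , _ , _) (_ , _ , refl , ℓ<max) = <⇒≱ ℓ<max (maxL≤lastOr0 sorted)

InLabel-unique : ∀ L L′ → InLabel L a → InLabel L′ a → L ≡ L′
InLabel-unique (lblA _ _) (lblA _ _) (_ , _ , refl , refl) (_ , _ , refl , refl) = refl
InLabel-unique (lblE _ _) (lblE _ _) (_ , refl , refl , _) (_ , refl , refl , _) = refl
InLabel-unique (lblA _ _) (lblE _ _) inA inE = ⊥-elim (InA⇒¬InE inA inE)
InLabel-unique (lblE _ _) (lblA _ _) inE inA = ⊥-elim (InA⇒¬InE inA inE)

𝒥-partition : (a : List ℕ) → InJ a → ∃! _≡_ (λ L → InLabel L a)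
𝒥-partition a j@(inv , _) with ¬Valley⇒Linked⊎lastOr0<maxL a (InJ⇒¬Valley j)
... | inj₁ sorted   = lblA _ _ , inA , λ {L′} → InLabel-unique _ L′ inA
  where inA = inv , sorted , refl , refl
... | inj₂ last<max = lblE _ _ , inE , λ {L′} → InLabel-unique _ L′ inE
  where inE = j , refl , refl , last<max

𝒜-successors : (n h : ℕ) (a : List ℕ) → InA n h a → (i : ℕ) →
  ((InJ (a ∷ʳ i) → (h ≤ i × i ≤ n) ⊎ i < h)
  × (h ≤ i → i ≤ n → InJ (a ∷ʳ i) × InA (suc n) i (a ∷ʳ i))
  × (i < h → InE (suc n) i (a ∷ʳ i)))
𝒜-successors _ _ a (inv , sorted , refl , refl) i = classify , staysInA , InE-∷ʳ a inv ¬v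
  where
  ¬v : ¬ Valley (a ∷ʳ i)
  ¬v = Linked⇒¬Valley-∷ʳ sorted
  classify : InJ (a ∷ʳ i) → (lastOr0 a ≤ i × i ≤ length a) ⊎ i < lastOr0 a
  classify (inv′ , _) = Sum.map₁ (_, IsInv-∷ʳ⁻ a inv′) (≤-<-connex (lastOr0 a) i)
  staysInA : lastOr0 a ≤ i → i ≤ length a → InJ (a ∷ʳ i) × InA (suc (length a)) i (a ∷ʳ i)
  staysInA h≤i i≤n =
    ¬Valley⇒InJ inv′ ¬v , inv′ , Linked-∷ʳ⁺ sorted h≤i , length-∷ʳ a i , lastOr0-∷ʳ a i
    where inv′ = IsInv-∷ʳ⁺ a inv i≤n

ℰ-successors : (n ℓ : ℕ) (a : List ℕ) → InE n ℓ a → (i : ℕ) →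
  ((InJ (a ∷ʳ i) → i < ℓ) × (i < ℓ → InE (suc n) i (a ∷ʳ i)))
ℰ-successors _ _ a (j@(inv , _) , refl , refl , ℓ<max) i = belowLast , staysInE
  where
  belowLast : InJ (a ∷ʳ i) → i < lastOr0 a
  belowLast j′ with i <? lastOr0 a
  ... | yes i<ℓ = i<ℓ
  ... | no i≮ℓ  = ⊥-elim (InJ⇒¬Valley j′
    (DescentTo⇒Valley-∷ʳ (lastOr0<maxL⇒DescentTo a ℓ<max) (≮⇒≥ i≮ℓ)))
  staysInE : i < lastOr0 a → InE (suc (length a)) i (a ∷ʳ i)
  staysInE i<ℓ = InE-∷ʳ a inv (¬Valley-∷ʳ-below-last a (InJ⇒¬Valley j) i<ℓ) i<ℓ

mainTheorem11 :
    ((a : List ℕ) → InJ a → ∃! _≡_ (λ L → InLabel L a))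
    × ((n h : ℕ) (a : List ℕ) → InA n h a → (i : ℕ) →
         ((InJ (a ∷ʳ i) → (h ≤ i × i ≤ n) ⊎ i < h)
          × (h ≤ i → i ≤ n → InJ (a ∷ʳ i) × InA (suc n) i (a ∷ʳ i))
          × (i < h → InE (suc n) i (a ∷ʳ i))))
    × ((n ℓ : ℕ) (a : List ℕ) → InE n ℓ a → (i : ℕ) →
         ((InJ (a ∷ʳ i) → i < ℓ)
          × (i < ℓ → InE (suc n) i (a ∷ʳ i))))
mainTheorem11 = 𝒥-partition , 𝒜-successors , ℰ-successors
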